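{- Let $n\ge1$, let $\lambda$ be a partition with $n$ parts, and let $1\le i\le n-1$. Then \[ \frac{1}{x_{i+1}}Z_\lambda(x_1,\ldots,x_i,x_{i+1},\ldots,x_n|a)=\frac{1}{x_i}Z_\lambda(x_1,\ldots,x_{i+1},x_i,\ldots,x_n|a), \] where the right-hand side is $Z_\lambda$ with the variables $x_i$ and $x_{i+1}$ interchanged.
   Context: Let $\lambda=(\lambda_1\ge\cdots\ge\lambda_n\ge0)$. Consider the grid of vertices $(r,c)$, $1\le r\le n$ (rows, top to bottom), $1\le c\le n+\lambda_1$ (columns, left to right), with horizontal edges between $(r,c),(r,c+1)$, vertical edges between $(r,c),(r+1,c)$, and boundary edges: a west boundary edge at each vertex of column 1, an east one at each vertex of column $n+\lambda_1$, a north one at each vertex of row 1, a south one at each vertex of row $n$. A state places on every edge one hydrogen atom bonded to exactly one endpoint (for boundary edges: its grid vertex or the outside) so that every vertex is bonded to exactly two of the hydrogens on its four incident edges. The $\lambda$-boundary condition: all west and east boundary hydrogens are bonded to their grid vertex, no south boundary hydrogen is, and the north boundary hydrogen in column $c$ is bonded to $(1,c)$ iff $c\notin\{\lambda_k+n+1-k:1\le k\le n\}$. The weight of vertex $(r,c)$ is $x_r/a_c$ if its bonded hydrogens are on its north and south edges, $x_r/a_c-1$ if on its north and west edges, and $1$ otherwise. $Z_\lambda(x|a)$, with $x=(x_1,\ldots,x_n)$ and $a=(a_1,a_2,\ldots)$ indeterminates, is the sum over all states with the $\lambda$-boundary condition of the product of all vertex weights. -}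

module Defs where

open import Data.Bool using (Bool; true; false; _∧_; _∨_; not; if_then_else_)
open import Data.Nat using (ℕ; zero; suc; _∸_; _≤_; _≡ᵇ_) renaming (_+_ to _+ℕ_)
open import Data.List using (List; []; _∷_; concatMap; map; foldr; upTo)
open import Data.Bool.ListAction using (all; any)
open import Data.Vec using (Vec; []; _∷_)
open import Data.Rational using (ℚ; 0ℚ; 1ℚ; _+_; _*_; _-_; _÷_; NonZero)

nth : {A : Set} → List A → ℕ → A → A
nth []       _       d = d
nth (y ∷ _)  zero    _ = y
nth (_ ∷ ys) (suc k) d = nth ys k d

at : {n : ℕ} → Vec ℚ n → ℕ → ℚ
at []       _       = 0ℚ
at (y ∷ _)  zero    = y
at (_ ∷ ys) (suc k) = at ys k

atℕ : {n : ℕ} → Vec ℕ n → ℕ → ℕ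
atℕ []       _       = 0
atℕ (y ∷ _)  zero    = y
atℕ (_ ∷ ys) (suc k) = atℕ ys k

swapAt : {n : ℕ} → ℕ → Vec ℚ n → Vec ℚ n
swapAt zero    (p ∷ q ∷ t) = q ∷ p ∷ t
swapAt (suc k) (p ∷ t)     = p ∷ swapAt k t
swapAt _       v           = v

data IsPartition : {n : ℕ} → Vec ℕ n → Set where
  nil  : IsPartition []
  one  : (p : ℕ) → IsPartition (p ∷ [])
  cons : {n : ℕ} (p q : ℕ) (t : Vec ℕ n) → q ≤ p →
         IsPartition (q ∷ t) → IsPartition (p ∷ q ∷ t)

lam1 : {n : ℕ} → Vec ℕ n → ℕ
lam1 []      = 0
lam1 (p ∷ _) = p

arrays : {B : Set} → ℕ → List B → List (List B)
arrays zero    xs = [] ∷ []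
arrays (suc k) xs = concatMap (λ rest → map (λ b → b ∷ rest) xs) (arrays k xs)

bools : List Bool
bools = true ∷ false ∷ []

sumℚ : List ℚ → ℚ
sumℚ = foldr _+_ 0ℚ

prodℚ : List ℚ → ℚ
prodℚ = foldr _*_ 1ℚ

b2n : Bool → ℕ
b2n true  = 1
b2n false = 0

-- Encoding of states.  Rows r = 0..n-1 (row r+1 of the paper), columns
-- c = 0..N-1 with N = n + λ_1 (column c+1 of the paper).
--
-- Horizontal edges: H is a list of n rows, each of N+1 booleans; entry j of
-- row r is the edge between columns j-1 and j (j = 0: west boundary edge of
-- (r,0); j = N: east boundary edge of (r,N-1)).  Value true means the
-- hydrogen is bonded to the RIGHT endpoint (column j), false: left endpoint.
--
-- Vertical edges: V is a list of n+1 rows, each of N booleans; entry c of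
-- row i is the edge between rows i-1 and i in column c (i = 0: north
-- boundary edge; i = n: south boundary edge).  Value true means the
-- hydrogen is bonded to the LOWER endpoint (row i), false: upper endpoint.

module _ {n : ℕ} (lam : Vec ℕ n) where

  ncols : ℕ
  ncols = n +ℕ lam1 lam

  -- 0-based column c is in {λ_k + n + 1 - k} (1-based) iff
  -- c = λ_{k0} + n - 1 - k0 for some 0-based k0 < n.
  inS : ℕ → Bool
  inS c = any (λ k → c ≡ᵇ (atℕ lam k +ℕ n) ∸ 1 ∸ k) (upTo n)

  module _ (H V : List (List Bool)) where

    hb : ℕ → ℕ → Bool
    hb r j = nth (nth H r []) j false

    vb : ℕ → ℕ → Bool
    vb i c = nth (nth V i []) c false

    -- which hydrogens are bonded to vertex (r,c)
    bW bE bN bS : ℕ → ℕ → Bool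
    bW r c = hb r c
    bE r c = not (hb r (suc c))
    bN r c = vb r c
    bS r c = not (vb (suc r) c)

    vertexOK : ℕ → ℕ → Bool
    vertexOK r c =
      (b2n (bW r c) +ℕ b2n (bE r c) +ℕ b2n (bN r c) +ℕ b2n (bS r c)) ≡ᵇ 2

    boundaryOK : Bool
    boundaryOK =
      all (λ r → hb r 0 ∧ not (hb r ncols)) (upTo n)
      ∧ all (λ c → vb n c ∧ (vb 0 c ∧ not (inS c) ∨ not (vb 0 c) ∧ inS c)) (upTo ncols)

    valid : Bool
    valid = boundaryOK ∧ all (λ r → all (λ c → vertexOK r c) (upTo ncols)) (upTo n)

    -- x : Vec ℚ n gives x_1..x_n; a k stands for a_{k+1}.
    weight : Vec ℚ n → (a : ℕ → ℚ) → (∀ k → NonZero (a k)) → ℕ → ℕ → ℚ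
    weight x a anz r c =
      if bN r c ∧ bS r c then (at x r ÷ a c) {{anz c}}
      else if bN r c ∧ bW r c then (at x r ÷ a c) {{anz c}} - 1ℚ
      else 1ℚ

    stateWeight : Vec ℚ n → (a : ℕ → ℚ) → (∀ k → NonZero (a k)) → ℚ
    stateWeight x a anz =
      prodℚ (concatMap (λ r → map (λ c → weight x a anz r c) (upTo ncols)) (upTo n))

  Z : Vec ℚ n → (a : ℕ → ℚ) → (∀ k → NonZero (a k)) → ℚ
  Z x a anz =
    sumℚ (concatMap (λ H → map (λ V →
            if valid H V then stateWeight H V x a anz else 0ℚ)
          (arrays (suc n) (arrays ncols bools)))
        (arrays n (arrays (suc ncols) bools)))

-- Cutting the lattice into rows gives Z_λ(x|a) = b_Nᵀ T(x₁) ⋯ T(xₙ) b_S, where the row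
-- transfer matrix T(p) is in turn a product of vertex weights along the row.  The weights of
-- two stacked rows with parameters p and q satisfy a local Yang–Baxter relation
-- R D(q,p) = D(p,q) R for an explicit R-matrix R(p,q) acting on pairs of horizontal edges.
-- Pushing R through a double row (the train argument), where it acts at the east end by the
-- scalar p and at the west end by q, yields the exchange relation p T(p)T(q) = q T(q)T(p);
-- for the adjacent rows i, i+1 this is x_i Z(x) = x_{i+1} Z(x with x_i and x_{i+1} swapped).
module Submission where

open import Defs
open import Data.Nat using (ℕ; _≤_; _<_; _∸_)
open import Data.Vec using (Vec)
open import Data.Rational using (ℚ; _*_; 1/_; NonZero)
open import Relation.Binary.PropositionalEquality using (_≡_)

open import Level using (0ℓ)
open import Algebra.Bundles.Raw using (RawRing)
open import Data.Bool using (Bool; true; false; _∧_; _∨_; not; if_then_else_)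
open import Data.List using (List; []; _∷_; _++_; foldr; map; concatMap; upTo; applyUpTo; cartesianProduct)
open import Data.List.Properties using (map-++; map-∘; map-concatMap)
open import Data.Bool.ListAction using (all)
open import Relation.Nullary.Decidable using (dec⇒maybe)
open import Data.Nat using (zero; suc; s≤s; _≡ᵇ_) renaming (_+_ to _+ℕ_)
open import Data.Product using (_×_; _,_)
open import Data.Vec.N-ary using (N-ary)
open import Data.Vec using ([]; _∷_)
open import Data.Rational using (0ℚ; 1ℚ; _+_)
open import Data.Rational.Base using (+-*-rawRing)
open import Data.Rational.Properties
  using (+-*-commutativeRing; _≟_; +-identityˡ; +-identityʳ; +-assoc; *-identityˡ; *-identityʳ;
         *-zeroˡ; *-zeroʳ; *-assoc; *-comm; *-distribˡ-+; *-inverseˡ)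
open import Relation.Binary.PropositionalEquality using (refl; sym; trans; cong; cong₂; module ≡-Reasoning)
open import Tactic.RingSolver using (solve-∀)
import Tactic.RingSolver.NonReflective
open import Tactic.RingSolver.Core.AlmostCommutativeRing using (AlmostCommutativeRing; fromCommutativeRing)
open import Algebra.Bundles using (CommutativeRing)
open import Algebra.Properties.CommutativeSemigroup (CommutativeRing.*-commutativeSemigroup +-*-commutativeRing)
  using () renaming (interchange to *-interchange; x∙yz≈y∙xz to x*yz≡y*xz)
open import Algebra.Properties.CommutativeSemigroup (CommutativeRing.+-commutativeSemigroup +-*-commutativeRing)
  using () renaming (interchange to +-interchange)
open ≡-Reasoning

ℚ-ring : AlmostCommutativeRing _ _
ℚ-ring = fromCommutativeRing +-*-commutativeRing (λ x → dec⇒maybe (0ℚ ≟ x))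

module Polynomial = Tactic.RingSolver.NonReflective ℚ-ring

module FiniteSums (ring : RawRing 0ℓ 0ℓ) where
  open RawRing ring using (Carrier; 0#; 1#) renaming (_+_ to _+′_; _*_ to _*′_)

  ∑ : {A : Set} → List A → (A → Carrier) → Carrier
  ∑ xs f = foldr _+′_ 0# (map f xs)

  ⟦_⟧ : Bool → Carrier
  ⟦ b ⟧ = if b then 1# else 0#

  apply : {S : Set} → List S → (S → S → Carrier) → (S → Carrier) → S → Carrier
  apply states M v s = ∑ states (λ t → M s t *′ v t)

  compose : {S : Set} → List S → (S → S → Carrier) → (S → S → Carrier) → S → S → Carrier
  compose states M N s u = ∑ states (λ t → M s t *′ N t u)

  _⊗_ : {S : Set} → (S → Carrier) → (S → Carrier) → S × S → Carrier
  (e₁ ⊗ e₂) (s₁ , s₂) = e₁ s₁ *′ e₂ s₂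

  contract : {S M : Set} → List M → (M → S → S → Carrier) → (M → S → S → Carrier) → S × S → S × S → Carrier
  contract middle A B (s₁ , s₂) (t₁ , t₂) = ∑ middle (λ m → A m s₁ t₁ *′ B m s₂ t₂)

pairs : List (Bool × Bool)
pairs = cartesianProduct bools bools

-- The weights are defined over any raw ring so that their identities can be checked on
-- formal polynomials, where the library's normaliser decides them; over ℚ the polynomial
-- proofs evaluate to exactly the statements about the weights.
module SixVertex (ring : RawRing 0ℓ 0ℓ) where
  open RawRing ring using (Carrier; 0#; 1#) renaming (_+_ to _+′_; _*_ to _*′_; -_ to -′_)
  open FiniteSums ring

  -- Spectral parameter t = x_r / a_c; the bits are those of the west, north, east and
  -- south edges of the vertex, in the encoding of Defs.
  cell : Carrier → Bool → Bool → Bool → Bool → Carrier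
  cell t w n e s = ⟦ allowed ⟧ *′ value
    where
    allowed : Bool
    allowed = (b2n w +ℕ b2n (not e) +ℕ b2n n +ℕ b2n (not s)) ≡ᵇ 2
    value : Carrier
    value = if n ∧ not s then t else if n ∧ w then t +′ -′ 1# else 1#

  -- In the encoding of Defs every west boundary edge has bit true, every east one bit false.
  eastBoundary : Bool → Carrier
  eastBoundary e = ⟦ not e ⟧

  doubleCell : Carrier → Carrier → Carrier → Bool → Bool → Bool × Bool → Bool × Bool → Carrier
  doubleCell p q w n s = contract bools (λ m w′ e → cell (p *′ w) w′ n e m) (λ m w′ e → cell (q *′ w) w′ m e s)

  R : Carrier → Carrier → Bool × Bool → Bool × Bool → Carrier
  R p q (false , false) (false , false) = p
  R p q (true  , true ) (true  , true ) = q
  R p q (false , true ) (false , true ) = p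
  R p q (true  , false) (true  , false) = q
  R p q (true  , false) (false , true ) = p +′ -′ q
  R p q _               _               = 0#

  table : Carrier → Carrier → Carrier → Carrier → Bool × Bool → Carrier
  table g₁ g₂ g₃ g₄ (true  , true ) = g₁
  table g₁ g₂ g₃ g₄ (true  , false) = g₂
  table g₁ g₂ g₃ g₄ (false , true ) = g₃
  table g₁ g₂ g₃ g₄ (false , false) = g₄

open FiniteSums +-*-rawRing
open SixVertex +-*-rawRing

private variable
  A B C : Set

∑-cong : (xs : List A) {f g : A → ℚ} → (∀ x → f x ≡ g x) → ∑ xs f ≡ ∑ xs g
∑-cong []       f≗g = refl
∑-cong (x ∷ xs) f≗g = cong₂ _+_ (f≗g x) (∑-cong xs f≗g)

∑-+ : (xs : List A) (f g : A → ℚ) → ∑ xs (λ x → f x + g x) ≡ ∑ xs f + ∑ xs g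
∑-+ []       f g = sym (+-identityʳ 0ℚ)
∑-+ (x ∷ xs) f g = trans (cong (f x + g x +_) (∑-+ xs f g)) (+-interchange (f x) (g x) (∑ xs f) (∑ xs g))

∑-*ˡ : (xs : List A) (c : ℚ) (f : A → ℚ) → ∑ xs (λ x → c * f x) ≡ c * ∑ xs f
∑-*ˡ []       c f = sym (*-zeroʳ c)
∑-*ˡ (x ∷ xs) c f = trans (cong (c * f x +_) (∑-*ˡ xs c f)) (sym (*-distribˡ-+ c (f x) (∑ xs f)))

∑-*ʳ : (xs : List A) (c : ℚ) (f : A → ℚ) → ∑ xs (λ x → f x * c) ≡ ∑ xs f * c
∑-*ʳ xs c f = trans (∑-cong xs (λ x → *-comm (f x) c)) (trans (∑-*ˡ xs c f) (*-comm c (∑ xs f)))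

*-∑-inner : (xs : List A) (c : ℚ) (f g : A → ℚ) →
  c * ∑ xs (λ x → f x * g x) ≡ ∑ xs (λ x → f x * (c * g x))
*-∑-inner xs c f g = trans (sym (∑-*ˡ xs c _)) (∑-cong xs (λ x → x*yz≡y*xz c (f x) (g x)))

∑-zero : (xs : List A) → ∑ xs (λ _ → 0ℚ) ≡ 0ℚ
∑-zero []       = refl
∑-zero (x ∷ xs) = trans (cong (0ℚ +_) (∑-zero xs)) (+-identityʳ 0ℚ)

sumℚ-++ : (xs ys : List ℚ) → sumℚ (xs ++ ys) ≡ sumℚ xs + sumℚ ys
sumℚ-++ []       ys = sym (+-identityˡ (sumℚ ys))
sumℚ-++ (x ∷ xs) ys = trans (cong (x +_) (sumℚ-++ xs ys)) (sym (+-assoc x (sumℚ xs) (sumℚ ys)))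

∑-++ : (xs ys : List A) (f : A → ℚ) → ∑ (xs ++ ys) f ≡ ∑ xs f + ∑ ys f
∑-++ xs ys f = trans (cong sumℚ (map-++ f xs ys)) (sumℚ-++ (map f xs) (map f ys))

∑-*-∑ : (xs : List A) (ys : List B) (f : A → ℚ) (g : B → ℚ) →
  ∑ xs f * ∑ ys g ≡ ∑ xs (λ x → ∑ ys (λ y → f x * g y))
∑-*-∑ xs ys f g = begin
  ∑ xs f * ∑ ys g                           ≡⟨ ∑-*ʳ xs (∑ ys g) f ⟨
  ∑ xs (λ x → f x * ∑ ys g)                 ≡⟨ ∑-cong xs (λ x → ∑-*ˡ ys (f x) g) ⟨
  ∑ xs (λ x → ∑ ys (λ y → f x * g y))       ∎

∑-comm : (xs : List A) (ys : List B) (f : A → B → ℚ) →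
  ∑ xs (λ x → ∑ ys (f x)) ≡ ∑ ys (λ y → ∑ xs (λ x → f x y))
∑-comm []       ys f = sym (∑-zero ys)
∑-comm (x ∷ xs) ys f = trans (cong (∑ ys (f x) +_) (∑-comm xs ys f))
                             (sym (∑-+ ys (f x) (λ y → ∑ xs (λ x → f x y))))

∑-comm₃ : (xs : List A) (ys : List B) (zs : List C) (f : A → B → C → ℚ) →
  ∑ xs (λ x → ∑ ys (λ y → ∑ zs (f x y))) ≡ ∑ ys (λ y → ∑ zs (λ z → ∑ xs (λ x → f x y z)))
∑-comm₃ xs ys zs f = trans (∑-comm xs ys (λ x y → ∑ zs (f x y)))
                           (∑-cong ys (λ y → ∑-comm xs zs (λ x → f x y)))

∑-map : (g : B → A) (xs : List B) (f : A → ℚ) → ∑ (map g xs) f ≡ ∑ xs (λ x → f (g x))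
∑-map g xs f = cong sumℚ (sym (map-∘ xs))

sumℚ-concatMap : (h : B → List ℚ) (xs : List B) →
  sumℚ (concatMap h xs) ≡ ∑ xs (λ x → sumℚ (h x))
sumℚ-concatMap h []       = refl
sumℚ-concatMap h (x ∷ xs) = trans (sumℚ-++ (h x) (concatMap h xs))
                                  (cong (sumℚ (h x) +_) (sumℚ-concatMap h xs))

∑-concatMap : (g : B → List A) (xs : List B) (f : A → ℚ) →
  ∑ (concatMap g xs) f ≡ ∑ xs (λ x → ∑ (g x) f)
∑-concatMap g xs f = trans (cong sumℚ (map-concatMap f g xs)) (sumℚ-concatMap (λ x → map f (g x)) xs)

∑-arrays-zero : (xs : List A) (f : List A → ℚ) → ∑ (arrays 0 xs) f ≡ f []
∑-arrays-zero xs f = +-identityʳ (f [])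

∑-arrays-suc : (k : ℕ) (xs : List A) (f : List A → ℚ) →
  ∑ (arrays (suc k) xs) f ≡ ∑ (arrays k xs) (λ w → ∑ xs (λ x → f (x ∷ w)))
∑-arrays-suc k xs f = trans (∑-concatMap (λ w → map (_∷ w) xs) (arrays k xs) f)
                            (∑-cong (arrays k xs) (λ w → ∑-map (_∷ w) xs f))

∑-cartesianProduct : (xs : List A) (ys : List B) (f : A × B → ℚ) →
  ∑ (cartesianProduct xs ys) f ≡ ∑ xs (λ x → ∑ ys (λ y → f (x , y)))
∑-cartesianProduct []       ys f = refl
∑-cartesianProduct (x ∷ xs) ys f = begin
  ∑ (map (x ,_) ys ++ cartesianProduct xs ys) f
    ≡⟨ ∑-++ (map (x ,_) ys) (cartesianProduct xs ys) f ⟩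
  ∑ (map (x ,_) ys) f + ∑ (cartesianProduct xs ys) f
    ≡⟨ cong₂ _+_ (∑-map (x ,_) ys f) (∑-cartesianProduct xs ys f) ⟩
  ∑ ys (λ y → f (x , y)) + ∑ xs (λ x′ → ∑ ys (λ y → f (x′ , y))) ∎

∑-bools-⟦⟧ : (f : Bool → ℚ) → ∑ bools (λ b → ⟦ b ⟧ * f b) ≡ f true
∑-bools-⟦⟧ f = drop (f true) (f false)
  where
  drop : ∀ x y → 1ℚ * x + (0ℚ * y + 0ℚ) ≡ x
  drop = solve-∀ ℚ-ring

⟦∧⟧ : ∀ a b → ⟦ a ∧ b ⟧ ≡ ⟦ a ⟧ * ⟦ b ⟧
⟦∧⟧ true  b = sym (*-identityˡ ⟦ b ⟧)
⟦∧⟧ false b = sym (*-zeroˡ ⟦ b ⟧)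

if-then-0 : ∀ b x → (if b then x else 0ℚ) ≡ ⟦ b ⟧ * x
if-then-0 true  x = sym (*-identityˡ x)
if-then-0 false x = sym (*-zeroˡ x)

⟦all-∧⟧ : (p q : A → Bool) (xs : List A) →
  ⟦ all (λ x → p x ∧ q x) xs ⟧ ≡ ⟦ all p xs ⟧ * ⟦ all q xs ⟧
⟦all-∧⟧ p q []       = sym (*-identityˡ 1ℚ)
⟦all-∧⟧ p q (x ∷ xs) = begin
  ⟦ (p x ∧ q x) ∧ all (λ y → p y ∧ q y) xs ⟧
    ≡⟨ trans (⟦∧⟧ (p x ∧ q x) _) (cong₂ _*_ (⟦∧⟧ (p x) (q x)) (⟦all-∧⟧ p q xs)) ⟩
  (⟦ p x ⟧ * ⟦ q x ⟧) * (⟦ all p xs ⟧ * ⟦ all q xs ⟧)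
    ≡⟨ *-interchange ⟦ p x ⟧ ⟦ q x ⟧ ⟦ all p xs ⟧ ⟦ all q xs ⟧ ⟩
  (⟦ p x ⟧ * ⟦ all p xs ⟧) * (⟦ q x ⟧ * ⟦ all q xs ⟧)
    ≡⟨ cong₂ _*_ (⟦∧⟧ (p x) (all p xs)) (⟦∧⟧ (q x) (all q xs)) ⟨
  ⟦ p x ∧ all p xs ⟧ * ⟦ q x ∧ all q xs ⟧ ∎

Π : ℕ → (ℕ → ℚ) → ℚ
Π zero    g = 1ℚ
Π (suc n) g = g 0 * Π n (λ r → g (suc r))

Π-cong : ∀ n {f g : ℕ → ℚ} → (∀ r → f r ≡ g r) → Π n f ≡ Π n g
Π-cong zero    f≗g = refl
Π-cong (suc n) f≗g = cong₂ _*_ (f≗g 0) (Π-cong n (λ r → f≗g (suc r)))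

Π-* : ∀ n (f g : ℕ → ℚ) → Π n (λ r → f r * g r) ≡ Π n f * Π n g
Π-* zero    f g = sym (*-identityˡ 1ℚ)
Π-* (suc n) f g = trans (cong (f 0 * g 0 *_) (Π-* n (λ r → f (suc r)) (λ r → g (suc r))))
                        (*-interchange (f 0) (g 0) (Π n (λ r → f (suc r))) (Π n (λ r → g (suc r))))

prodℚ-map-applyUpTo : ∀ n (f : ℕ → ℕ) (g : ℕ → ℚ) → prodℚ (map g (applyUpTo f n)) ≡ Π n (λ r → g (f r))
prodℚ-map-applyUpTo zero    f g = refl
prodℚ-map-applyUpTo (suc n) f g = cong (g (f 0) *_) (prodℚ-map-applyUpTo n (λ r → f (suc r)) g)

⟦all-applyUpTo⟧ : ∀ n (f : ℕ → ℕ) (p : ℕ → Bool) → ⟦ all p (applyUpTo f n) ⟧ ≡ Π n (λ r → ⟦ p (f r) ⟧)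
⟦all-applyUpTo⟧ zero    f p = refl
⟦all-applyUpTo⟧ (suc n) f p = trans (⟦∧⟧ (p (f 0)) _) (cong (⟦ p (f 0) ⟧ *_) (⟦all-applyUpTo⟧ n (λ r → f (suc r)) p))

prodℚ-concatMap-applyUpTo : ∀ n (f : ℕ → ℕ) (h : ℕ → List ℚ) →
  prodℚ (concatMap h (applyUpTo f n)) ≡ Π n (λ r → prodℚ (h (f r)))
prodℚ-concatMap-applyUpTo zero    f h = refl
prodℚ-concatMap-applyUpTo (suc n) f h = trans (prodℚ-++ (h (f 0)) _)
  (cong (prodℚ (h (f 0)) *_) (prodℚ-concatMap-applyUpTo n (λ r → f (suc r)) h))
  where
  prodℚ-++ : (xs ys : List ℚ) → prodℚ (xs ++ ys) ≡ prodℚ xs * prodℚ ys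
  prodℚ-++ []       ys = sym (*-identityˡ (prodℚ ys))
  prodℚ-++ (x ∷ xs) ys = trans (cong (x *_) (prodℚ-++ xs ys)) (sym (*-assoc x (prodℚ xs) (prodℚ ys)))

∑-arrays-Π : (xs : List A) (d : A) → ∀ k (f : ℕ → A → ℚ) →
  ∑ (arrays k xs) (λ w → Π k (λ r → f r (nth w r d))) ≡ Π k (λ r → ∑ xs (f r))
∑-arrays-Π xs d zero    f = ∑-arrays-zero xs (λ _ → 1ℚ)
∑-arrays-Π xs d (suc k) f = begin
  ∑ (arrays (suc k) xs) (λ w → Π (suc k) (λ r → f r (nth w r d)))
    ≡⟨ ∑-arrays-suc k xs _ ⟩
  ∑ (arrays k xs) (λ w → ∑ xs (λ x → f 0 x * rest w))
    ≡⟨ ∑-cong (arrays k xs) (λ w → ∑-*ʳ xs (rest w) (f 0)) ⟩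
  ∑ (arrays k xs) (λ w → ∑ xs (f 0) * rest w)
    ≡⟨ ∑-*ˡ (arrays k xs) (∑ xs (f 0)) rest ⟩
  ∑ xs (f 0) * ∑ (arrays k xs) rest
    ≡⟨ cong (∑ xs (f 0) *_) (∑-arrays-Π xs d k (λ r → f (suc r))) ⟩
  Π (suc k) (λ r → ∑ xs (f r)) ∎
  where
  rest : List _ → ℚ
  rest w = Π k (λ r → f (suc r) (nth w r d))

chain : {S : Set} → List S → ℕ → (ℕ → S → S → ℚ) → (S → ℚ) → S → ℚ
chain states zero    M e = e
chain states (suc k) M e = apply states (M 0) (chain states k (λ c → M (suc c)) e)

module _ {S : Set} (states : List S) where

  ∑-paths : (d : S) (e : S → ℚ) → ∀ k (M : ℕ → S → S → ℚ) s →
    ∑ (arrays k states) (λ w → e (nth (s ∷ w) k d) * Π k (λ r → M r (nth (s ∷ w) r d) (nth (s ∷ w) (suc r) d)))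
      ≡ chain states k M e s
  ∑-paths d e zero    M s = trans (∑-arrays-zero states (λ _ → e s * 1ℚ)) (*-identityʳ (e s))
  ∑-paths d e (suc k) M s = begin
    ∑ (arrays (suc k) states) path
      ≡⟨ ∑-arrays-suc k states path ⟩
    ∑ (arrays k states) (λ w → ∑ states (λ t → path (t ∷ w)))
      ≡⟨ ∑-comm (arrays k states) states (λ w t → path (t ∷ w)) ⟩
    ∑ states (λ t → ∑ (arrays k states) (λ w → path (t ∷ w)))
      ≡⟨ ∑-cong states (λ t → trans (∑-cong (arrays k states) (λ w → x*yz≡y*xz (end t w) (M 0 s t) (rest t w)))
                                     (∑-*ˡ (arrays k states) (M 0 s t) (λ w → end t w * rest t w))) ⟩
    ∑ states (λ t → M 0 s t * ∑ (arrays k states) (λ w → end t w * rest t w))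
      ≡⟨ ∑-cong states (λ t → cong (M 0 s t *_) (∑-paths d e k (λ c → M (suc c)) t)) ⟩
    chain states (suc k) M e s ∎
    where
    path : List S → ℚ
    path w = e (nth (s ∷ w) (suc k) d) * Π (suc k) (λ r → M r (nth (s ∷ w) r d) (nth (s ∷ w) (suc r) d))
    end : S → List S → ℚ
    end t w = e (nth (t ∷ w) k d)
    rest : S → List S → ℚ
    rest t w = Π k (λ r → M (suc r) (nth (t ∷ w) r d) (nth (t ∷ w) (suc r) d))

  module _ {M : Set} (middle : List M) where

    ∑-chain-* : (d : M) (A B : ℕ → M → S → S → ℚ) (e₁ e₂ : S → ℚ) → ∀ k s₁ s₂ →
      ∑ (arrays k middle) (λ w → chain states k (λ c → A c (nth w c d)) e₁ s₁
                               * chain states k (λ c → B c (nth w c d)) e₂ s₂)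
        ≡ chain (cartesianProduct states states) k (λ c → contract middle (A c) (B c)) (e₁ ⊗ e₂) (s₁ , s₂)
    ∑-chain-* d A B e₁ e₂ zero    s₁ s₂ = ∑-arrays-zero middle (λ _ → e₁ s₁ * e₂ s₂)
    ∑-chain-* d A B e₁ e₂ (suc k) s₁ s₂ = begin
      ∑ (arrays (suc k) middle) (λ w → chain states (suc k) (λ c → A c (nth w c d)) e₁ s₁
                                      * chain states (suc k) (λ c → B c (nth w c d)) e₂ s₂)
        ≡⟨ ∑-arrays-suc k middle _ ⟩
      ∑ W (λ w → ∑ middle (λ m → ∑ states (λ t₁ → A 0 m s₁ t₁ * X w t₁)
                               * ∑ states (λ t₂ → B 0 m s₂ t₂ * Y w t₂)))
        ≡⟨ ∑-cong W (λ w → ∑-cong middle (λ m → ∑-*-∑ states states _ _)) ⟩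
      ∑ W (λ w → ∑ middle (λ m → ∑ states (λ t₁ → ∑ states (λ t₂ → term w m t₁ t₂))))
        ≡⟨ ∑-comm₃ W middle states (λ w m t₁ → ∑ states (term w m t₁)) ⟩
      ∑ middle (λ m → ∑ states (λ t₁ → ∑ W (λ w → ∑ states (term w m t₁))))
        ≡⟨ ∑-cong middle (λ m → ∑-cong states (λ t₁ → ∑-comm W states (λ w → term w m t₁))) ⟩
      ∑ middle (λ m → ∑ states (λ t₁ → ∑ states (λ t₂ → ∑ W (λ w → term w m t₁ t₂))))
        ≡⟨ ∑-cong middle (λ m → ∑-cong states (λ t₁ → ∑-cong states (λ t₂ → factor m t₁ t₂))) ⟩
      ∑ middle (λ m → ∑ states (λ t₁ → ∑ states (λ t₂ → A 0 m s₁ t₁ * B 0 m s₂ t₂ * next t₁ t₂)))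
        ≡⟨ ∑-comm₃ middle states states (λ m t₁ t₂ → A 0 m s₁ t₁ * B 0 m s₂ t₂ * next t₁ t₂) ⟩
      ∑ states (λ t₁ → ∑ states (λ t₂ → ∑ middle (λ m → A 0 m s₁ t₁ * B 0 m s₂ t₂ * next t₁ t₂)))
        ≡⟨ ∑-cong states (λ t₁ → ∑-cong states (λ t₂ → ∑-*ʳ middle (next t₁ t₂) _)) ⟩
      ∑ states (λ t₁ → ∑ states (λ t₂ → contract middle (A 0) (B 0) (s₁ , s₂) (t₁ , t₂) * next t₁ t₂))
        ≡⟨ ∑-cartesianProduct states states _ ⟨
      chain (cartesianProduct states states) (suc k) (λ c → contract middle (A c) (B c)) (e₁ ⊗ e₂) (s₁ , s₂) ∎
      where
      W = arrays k middle
      X : List M → S → ℚ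
      X w = chain states k (λ c → A (suc c) (nth w c d)) e₁
      Y : List M → S → ℚ
      Y w = chain states k (λ c → B (suc c) (nth w c d)) e₂
      term : List M → M → S → S → ℚ
      term w m t₁ t₂ = A 0 m s₁ t₁ * X w t₁ * (B 0 m s₂ t₂ * Y w t₂)
      next : S → S → ℚ
      next t₁ t₂ = chain (cartesianProduct states states) k (λ c → contract middle (A (suc c)) (B (suc c))) (e₁ ⊗ e₂) (t₁ , t₂)
      factor : ∀ m t₁ t₂ → ∑ W (λ w → term w m t₁ t₂) ≡ A 0 m s₁ t₁ * B 0 m s₂ t₂ * next t₁ t₂
      factor m t₁ t₂ = begin
        ∑ W (λ w → term w m t₁ t₂)
          ≡⟨ ∑-cong W (λ w → *-interchange (A 0 m s₁ t₁) (X w t₁) (B 0 m s₂ t₂) (Y w t₂)) ⟩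
        ∑ W (λ w → A 0 m s₁ t₁ * B 0 m s₂ t₂ * (X w t₁ * Y w t₂))
          ≡⟨ ∑-*ˡ W (A 0 m s₁ t₁ * B 0 m s₂ t₂) (λ w → X w t₁ * Y w t₂) ⟩
        A 0 m s₁ t₁ * B 0 m s₂ t₂ * ∑ W (λ w → X w t₁ * Y w t₂)
          ≡⟨ cong (A 0 m s₁ t₁ * B 0 m s₂ t₂ *_) (∑-chain-* d (λ c → A (suc c)) (λ c → B (suc c)) e₁ e₂ k t₁ t₂) ⟩
        A 0 m s₁ t₁ * B 0 m s₂ t₂ * next t₁ t₂ ∎

  chain-intertwine : (Ř : S → S → ℚ) (μ : ℚ) (M M′ : ℕ → S → S → ℚ) (e : S → ℚ) →
    (∀ c G s → apply states Ř (apply states (M c) G) s ≡ apply states (M′ c) (apply states Ř G) s) →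
    (∀ s → apply states Ř e s ≡ μ * e s) →
    ∀ k s → apply states Ř (chain states k M e) s ≡ μ * chain states k M′ e s
  chain-intertwine Ř μ M M′ e ŘM≡M′Ř Ře≡μe zero    s = Ře≡μe s
  chain-intertwine Ř μ M M′ e ŘM≡M′Ř Ře≡μe (suc k) s = begin
    apply states Ř (apply states (M 0) (chain states k (λ c → M (suc c)) e)) s
      ≡⟨ ŘM≡M′Ř 0 (chain states k (λ c → M (suc c)) e) s ⟩
    apply states (M′ 0) (apply states Ř (chain states k (λ c → M (suc c)) e)) s
      ≡⟨ ∑-cong states (λ t → cong (M′ 0 s t *_)
           (chain-intertwine Ř μ (λ c → M (suc c)) (λ c → M′ (suc c)) e (λ c → ŘM≡M′Ř (suc c)) Ře≡μe k t)) ⟩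
    ∑ states (λ t → M′ 0 s t * (μ * chain states k (λ c → M′ (suc c)) e t))
      ≡⟨ *-∑-inner states μ (M′ 0 s) (chain states k (λ c → M′ (suc c)) e) ⟨
    μ * chain states (suc k) M′ e s ∎

  apply-compose : (M N : S → S → ℚ) (v : S → ℚ) (s : S) →
    apply states M (apply states N v) s ≡ apply states (compose states M N) v s
  apply-compose M N v s = begin
    ∑ states (λ t → M s t * ∑ states (λ u → N t u * v u))
      ≡⟨ ∑-cong states (λ t → ∑-*ˡ states (M s t) (λ u → N t u * v u)) ⟨
    ∑ states (λ t → ∑ states (λ u → M s t * (N t u * v u)))
      ≡⟨ ∑-comm states states _ ⟩
    ∑ states (λ u → ∑ states (λ t → M s t * (N t u * v u)))
      ≡⟨ ∑-cong states (λ u → trans (∑-cong states (λ t → sym (*-assoc (M s t) (N t u) (v u))))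
                                    (∑-*ʳ states (v u) (λ t → M s t * N t u))) ⟩
    ∑ states (λ u → compose states M N s u * v u) ∎

  *-apply : (c : ℚ) (M : S → S → ℚ) (v : S → ℚ) (s : S) →
    c * apply states M v s ≡ apply states (λ s′ u → c * M s′ u) v s
  *-apply c M v s = trans (sym (∑-*ˡ states c _)) (∑-cong states (λ u → sym (*-assoc c (M s u) (v u))))

  chain-swapAt : (T : ℚ → S → S → ℚ) →
    (∀ p q s u → p * compose states (T p) (T q) s u ≡ q * compose states (T q) (T p) s u) →
    ∀ j k (x : Vec ℚ k) → suc j < k → ∀ (e : S → ℚ) s →
    at x j * chain states k (λ r → T (at x r)) e s ≡ at x (suc j) * chain states k (λ r → T (at (swapAt j x) r)) e s
  chain-swapAt T exchange zero (suc (suc k)) (p ∷ q ∷ xs) _ e s = begin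
    p * apply states (T p) (apply states (T q) rest) s
      ≡⟨ cong (p *_) (apply-compose (T p) (T q) rest s) ⟩
    p * apply states (compose states (T p) (T q)) rest s
      ≡⟨ *-apply p (compose states (T p) (T q)) rest s ⟩
    ∑ states (λ u → p * compose states (T p) (T q) s u * rest u)
      ≡⟨ ∑-cong states (λ u → cong (_* rest u) (exchange p q s u)) ⟩
    ∑ states (λ u → q * compose states (T q) (T p) s u * rest u)
      ≡⟨ *-apply q (compose states (T q) (T p)) rest s ⟨
    q * apply states (compose states (T q) (T p)) rest s
      ≡⟨ cong (q *_) (apply-compose (T q) (T p) rest s) ⟨
    q * apply states (T q) (apply states (T p) rest) s ∎
    where
    rest : S → ℚ
    rest = chain states k (λ r → T (at xs r)) e
  chain-swapAt T exchange zero (suc zero) (p ∷ []) (s≤s ()) e s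
  chain-swapAt T exchange (suc j) (suc k) (p ∷ xs) (s≤s j<k) e s = begin
    at xs j * ∑ states (λ t → T p s t * chain states k (λ r → T (at xs r)) e t)
      ≡⟨ *-∑-inner states (at xs j) (T p s) _ ⟩
    ∑ states (λ t → T p s t * (at xs j * chain states k (λ r → T (at xs r)) e t))
      ≡⟨ ∑-cong states (λ t → cong (T p s t *_) (chain-swapAt T exchange j k xs j<k e t)) ⟩
    ∑ states (λ t → T p s t * (at xs (suc j) * chain states k (λ r → T (at (swapAt j xs) r)) e t))
      ≡⟨ *-∑-inner states (at xs (suc j)) (T p s) _ ⟨
    at xs (suc j) * ∑ states (λ t → T p s t * chain states k (λ r → T (at (swapAt j xs) r)) e t) ∎


polynomials : ℕ → RawRing 0ℓ 0ℓ
polynomials k = record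
  { Carrier = Polynomial.Expr ℚ k ; _≈_ = _≡_
  ; _+_ = Polynomial._⊕_ ; _*_ = Polynomial._⊗_ ; -_ = Polynomial.⊝_
  ; 0# = Polynomial.Κ 0ℚ ; 1# = Polynomial.Κ 1ℚ }

module Formal (k : ℕ) where
  open FiniteSums (polynomials k) public
  open SixVertex (polynomials k) public

yang-baxter-polynomials : Bool → Bool → Bool × Bool →
  N-ary 7 (Polynomial.Expr ℚ 7) (Polynomial.Expr ℚ 7 × Polynomial.Expr ℚ 7)
yang-baxter-polynomials n s h p q w g₁ g₂ g₃ g₄ =
  F.apply pairs (F.R p q) (F.apply pairs (F.doubleCell q p w n s) G) h
    Polynomial.⊜ F.apply pairs (F.doubleCell p q w n s) (F.apply pairs (F.R p q) G) h
  where
  module F = Formal 7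
  G : Bool × Bool → Polynomial.Expr ℚ 7
  G = F.table g₁ g₂ g₃ g₄

yang-baxter-table : ∀ n s h p q w g₁ g₂ g₃ g₄ →
  apply pairs (R p q) (apply pairs (doubleCell q p w n s) (table g₁ g₂ g₃ g₄)) h
    ≡ apply pairs (doubleCell p q w n s) (apply pairs (R p q) (table g₁ g₂ g₃ g₄)) h
yang-baxter-table true  true  (true  , true ) = Polynomial.solve 7 (yang-baxter-polynomials true  true  (true  , true )) refl
yang-baxter-table true  true  (true  , false) = Polynomial.solve 7 (yang-baxter-polynomials true  true  (true  , false)) refl
yang-baxter-table true  true  (false , true ) = Polynomial.solve 7 (yang-baxter-polynomials true  true  (false , true )) refl
yang-baxter-table true  true  (false , false) = Polynomial.solve 7 (yang-baxter-polynomials true  true  (false , false)) refl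
yang-baxter-table true  false (true  , true ) = Polynomial.solve 7 (yang-baxter-polynomials true  false (true  , true )) refl
yang-baxter-table true  false (true  , false) = Polynomial.solve 7 (yang-baxter-polynomials true  false (true  , false)) refl
yang-baxter-table true  false (false , true ) = Polynomial.solve 7 (yang-baxter-polynomials true  false (false , true )) refl
yang-baxter-table true  false (false , false) = Polynomial.solve 7 (yang-baxter-polynomials true  false (false , false)) refl
yang-baxter-table false true  (true  , true ) = Polynomial.solve 7 (yang-baxter-polynomials false true  (true  , true )) refl
yang-baxter-table false true  (true  , false) = Polynomial.solve 7 (yang-baxter-polynomials false true  (true  , false)) refl
yang-baxter-table false true  (false , true ) = Polynomial.solve 7 (yang-baxter-polynomials false true  (false , true )) refl
yang-baxter-table false true  (false , false) = Polynomial.solve 7 (yang-baxter-polynomials false true  (false , false)) refl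
yang-baxter-table false false (true  , true ) = Polynomial.solve 7 (yang-baxter-polynomials false false (true  , true )) refl
yang-baxter-table false false (true  , false) = Polynomial.solve 7 (yang-baxter-polynomials false false (true  , false)) refl
yang-baxter-table false false (false , true ) = Polynomial.solve 7 (yang-baxter-polynomials false false (false , true )) refl
yang-baxter-table false false (false , false) = Polynomial.solve 7 (yang-baxter-polynomials false false (false , false)) refl

-- G agrees with the table of its four values, and only these remain once the sums unfold.
yang-baxter : ∀ p q w n s h (G : Bool × Bool → ℚ) →
  apply pairs (R p q) (apply pairs (doubleCell q p w n s) G) h
    ≡ apply pairs (doubleCell p q w n s) (apply pairs (R p q) G) h
yang-baxter p q w n s h G =
  yang-baxter-table n s h p q w (G (true , true)) (G (true , false)) (G (false , true)) (G (false , false))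

eastBoundary-polynomials : Bool × Bool → N-ary 2 (Polynomial.Expr ℚ 2) (Polynomial.Expr ℚ 2 × Polynomial.Expr ℚ 2)
eastBoundary-polynomials h p q =
  F.apply pairs (F.R p q) (F.eastBoundary F.⊗ F.eastBoundary) h
    Polynomial.⊜ p Polynomial.⊗ (F.eastBoundary F.⊗ F.eastBoundary) h
  where module F = Formal 2

R-eastBoundary : ∀ h p q →
  apply pairs (R p q) (eastBoundary ⊗ eastBoundary) h ≡ p * (eastBoundary ⊗ eastBoundary) h
R-eastBoundary (true  , true ) = Polynomial.solve 2 (eastBoundary-polynomials (true  , true )) refl
R-eastBoundary (true  , false) = Polynomial.solve 2 (eastBoundary-polynomials (true  , false)) refl
R-eastBoundary (false , true ) = Polynomial.solve 2 (eastBoundary-polynomials (false , true )) refl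
R-eastBoundary (false , false) = Polynomial.solve 2 (eastBoundary-polynomials (false , false)) refl

R-westBoundary : ∀ p q (G : Bool × Bool → ℚ) → apply pairs (R p q) G (true , true) ≡ q * G (true , true)
R-westBoundary p q G = table-case p q (G (true , true)) (G (true , false)) (G (false , true)) (G (false , false))
  where
  table-case : ∀ p q g₁ g₂ g₃ g₄ → apply pairs (R p q) (table g₁ g₂ g₃ g₄) (true , true) ≡ q * g₁
  table-case = Polynomial.solve 6 (λ p q g₁ g₂ g₃ g₄ →
    F.apply pairs (F.R p q) (F.table g₁ g₂ g₃ g₄) (true , true) Polynomial.⊜ q Polynomial.⊗ g₁) refl
    where module F = Formal 6

edge : List Bool → ℕ → Bool
edge v c = nth v c false

module Row (N : ℕ) (u : ℕ → ℚ) where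

  rowMatrix : ℚ → (ℕ → Bool) → (ℕ → Bool) → ℕ → Bool → Bool → ℚ
  rowMatrix p north south c w e = cell (p * u c) w (north c) e (south c)

  rowChain : ℚ → (ℕ → Bool) → (ℕ → Bool) → ℚ
  rowChain p north south = chain bools N (rowMatrix p north south) eastBoundary true

  doubleRow : ℚ → ℚ → (ℕ → Bool) → (ℕ → Bool) → Bool × Bool → ℚ
  doubleRow p q north south =
    chain pairs N (λ c → doubleCell p q (u c) (north c) (south c)) (eastBoundary ⊗ eastBoundary)

  ∑-rowChain-* : ∀ p q north south →
    ∑ (arrays N bools) (λ v → rowChain p north (edge v) * rowChain q (edge v) south)
      ≡ doubleRow p q north south (true , true)
  ∑-rowChain-* p q north south =
    ∑-chain-* bools bools false (λ c m w e → cell (p * u c) w (north c) e m)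
      (λ c m w e → cell (q * u c) w m e (south c)) eastBoundary eastBoundary N true true

  rowChain-exchange : ∀ p q north south →
    p * ∑ (arrays N bools) (λ v → rowChain p north (edge v) * rowChain q (edge v) south)
      ≡ q * ∑ (arrays N bools) (λ v → rowChain q north (edge v) * rowChain p (edge v) south)
  rowChain-exchange p q north south = begin
    p * ∑ (arrays N bools) (λ v → rowChain p north (edge v) * rowChain q (edge v) south)
      ≡⟨ cong (p *_) (∑-rowChain-* p q north south) ⟩
    p * doubleRow p q north south (true , true)
      ≡⟨ chain-intertwine pairs (R p q) p (λ c → doubleCell q p (u c) (north c) (south c))
           (λ c → doubleCell p q (u c) (north c) (south c)) (eastBoundary ⊗ eastBoundary)
           (λ c G h → yang-baxter p q (u c) (north c) (south c) h G) (λ h → R-eastBoundary h p q) N (true , true) ⟨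
    apply pairs (R p q) (doubleRow q p north south) (true , true)
      ≡⟨ R-westBoundary p q (doubleRow q p north south) ⟩
    q * doubleRow q p north south (true , true)
      ≡⟨ cong (q *_) (∑-rowChain-* q p north south) ⟨
    q * ∑ (arrays N bools) (λ v → rowChain q north (edge v) * rowChain p (edge v) south) ∎

module PartitionFunction {n : ℕ} (lam : Vec ℕ n) (a : ℕ → ℚ) (anz : ∀ k → NonZero (a k)) where

  N : ℕ
  N = ncols lam

  open Row N (λ c → (1/ a c) {{anz c}})

  rowWeight : ℚ → List Bool → List Bool → List Bool → ℚ
  rowWeight p h v v′ =
    ⟦ edge h 0 ⟧ * (eastBoundary (edge h N) * Π N (λ c → rowMatrix p (edge v) (edge v′) c (edge h c) (edge h (suc c))))

  transfer : ℚ → List Bool → List Bool → ℚ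
  transfer p v v′ = ∑ (arrays (suc N) bools) (λ h → rowWeight p h v v′)

  transfer≡rowChain : ∀ p v v′ → transfer p v v′ ≡ rowChain p (edge v) (edge v′)
  transfer≡rowChain p v v′ = begin
    ∑ (arrays (suc N) bools) (λ h → rowWeight p h v v′)
      ≡⟨ ∑-arrays-suc N bools _ ⟩
    ∑ (arrays N bools) (λ h → ∑ bools (λ b → rowWeight p (b ∷ h) v v′))
      ≡⟨ ∑-comm (arrays N bools) bools (λ h b → rowWeight p (b ∷ h) v v′) ⟩
    ∑ bools (λ b → ∑ (arrays N bools) (λ h → rowWeight p (b ∷ h) v v′))
      ≡⟨ ∑-cong bools (λ b → ∑-*ˡ (arrays N bools) ⟦ b ⟧ (path b)) ⟩
    ∑ bools (λ b → ⟦ b ⟧ * ∑ (arrays N bools) (path b))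
      ≡⟨ ∑-cong bools (λ b → cong (⟦ b ⟧ *_) (∑-paths bools false eastBoundary N M b)) ⟩
    ∑ bools (λ b → ⟦ b ⟧ * chain bools N M eastBoundary b)
      ≡⟨ ∑-bools-⟦⟧ (chain bools N M eastBoundary) ⟩
    rowChain p (edge v) (edge v′) ∎
    where
    M : ℕ → Bool → Bool → ℚ
    M = rowMatrix p (edge v) (edge v′)
    path : Bool → List Bool → ℚ
    path b h = eastBoundary (edge (b ∷ h) N) * Π N (λ c → M c (edge (b ∷ h) c) (edge (b ∷ h) (suc c)))

  verticals : List (List Bool)
  verticals = arrays N bools

  transfer-exchange : ∀ p q v v″ →
    p * compose verticals (transfer p) (transfer q) v v″ ≡ q * compose verticals (transfer q) (transfer p) v v″
  transfer-exchange p q v v″ = begin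
    p * compose verticals (transfer p) (transfer q) v v″
      ≡⟨ cong (p *_) (∑-cong verticals (rowChains p q)) ⟩
    p * ∑ (arrays N bools) (λ v′ → rowChain p (edge v) (edge v′) * rowChain q (edge v′) (edge v″))
      ≡⟨ rowChain-exchange p q (edge v) (edge v″) ⟩
    q * ∑ (arrays N bools) (λ v′ → rowChain q (edge v) (edge v′) * rowChain p (edge v′) (edge v″))
      ≡⟨ cong (q *_) (∑-cong verticals (rowChains q p)) ⟨
    q * compose verticals (transfer q) (transfer p) v v″ ∎
    where
    rowChains : ∀ p q v′ → transfer p v v′ * transfer q v′ v″
                         ≡ rowChain p (edge v) (edge v′) * rowChain q (edge v′) (edge v″)
    rowChains p q v′ = cong₂ _*_ (transfer≡rowChain p v v′) (transfer≡rowChain q v′ v″)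

  southBoundary : List Bool → ℚ
  southBoundary v = ⟦ all (edge v) (upTo N) ⟧

  northBoundary : List Bool → ℚ
  northBoundary v = ⟦ all (λ c → edge v c ∧ not (inS lam c) ∨ not (edge v c) ∧ inS lam c) (upTo N) ⟧

  module _ (x : Vec ℚ n) (H V : List (List Bool)) where

    westEast : ℕ → Bool
    westEast r = hb lam H V r 0 ∧ not (hb lam H V r N)

    vertices : ℕ → Bool
    vertices r = all (vertexOK lam H V r) (upTo N)

    weights : ℕ → List ℚ
    weights r = map (weight lam H V x a anz r) (upTo N)

    rows : ℕ → ℚ
    rows r = rowWeight (at x r) (nth H r []) (nth V r []) (nth V (suc r) [])

    row-factorises : ∀ r → ⟦ westEast r ⟧ * (⟦ vertices r ⟧ * prodℚ (weights r)) ≡ rows r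
    row-factorises r = begin
      ⟦ westEast r ⟧ * (⟦ vertices r ⟧ * prodℚ (weights r))
        ≡⟨ cong₂ _*_ (⟦∧⟧ (hb lam H V r 0) _)
                     (cong₂ _*_ (⟦all-applyUpTo⟧ N (λ c → c) (vertexOK lam H V r))
                                (prodℚ-map-applyUpTo N (λ c → c) (weight lam H V x a anz r))) ⟩
      ⟦ hb lam H V r 0 ⟧ * eastBoundary (hb lam H V r N)
        * (Π N (λ c → ⟦ vertexOK lam H V r c ⟧) * Π N (weight lam H V x a anz r))
        ≡⟨ cong (⟦ hb lam H V r 0 ⟧ * eastBoundary (hb lam H V r N) *_) (Π-* N _ _) ⟨
      ⟦ hb lam H V r 0 ⟧ * eastBoundary (hb lam H V r N)
        * Π N (λ c → ⟦ vertexOK lam H V r c ⟧ * weight lam H V x a anz r c)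
        ≡⟨ *-assoc ⟦ hb lam H V r 0 ⟧ (eastBoundary (hb lam H V r N)) _ ⟩
      rows r ∎

    state-factorises :
      (if valid lam H V then stateWeight lam H V x a anz else 0ℚ)
        ≡ southBoundary (nth V n []) * northBoundary (nth V 0 []) * Π n rows
    state-factorises = begin
      (if valid lam H V then SW else 0ℚ)
        ≡⟨ if-then-0 (valid lam H V) SW ⟩
      ⟦ (all westEast (upTo n) ∧ columns) ∧ all vertices (upTo n) ⟧ * SW
        ≡⟨ cong (_* SW) (trans (⟦∧⟧ (all westEast (upTo n) ∧ columns) (all vertices (upTo n)))
                               (cong (_* ⟦ all vertices (upTo n) ⟧) (⟦∧⟧ (all westEast (upTo n)) columns))) ⟩
      ⟦ all westEast (upTo n) ⟧ * ⟦ columns ⟧ * ⟦ all vertices (upTo n) ⟧ * SW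
        ≡⟨ cong₂ _*_ (cong₂ _*_ (cong₂ _*_ (⟦all-applyUpTo⟧ n (λ r → r) westEast) (⟦all-∧⟧ _ _ (upTo N)))
                                (⟦all-applyUpTo⟧ n (λ r → r) vertices))
                     (prodℚ-concatMap-applyUpTo n (λ r → r) weights) ⟩
      Π n (λ r → ⟦ westEast r ⟧) * (south * north) * Π n (λ r → ⟦ vertices r ⟧) * Π n (λ r → prodℚ (weights r))
        ≡⟨ regroup (Π n (λ r → ⟦ westEast r ⟧)) (south * north) (Π n (λ r → ⟦ vertices r ⟧)) (Π n (λ r → prodℚ (weights r))) ⟩
      south * north * (Π n (λ r → ⟦ westEast r ⟧) * (Π n (λ r → ⟦ vertices r ⟧) * Π n (λ r → prodℚ (weights r))))
        ≡⟨ cong (south * north *_) (trans (Π-* n _ _) (cong (Π n (λ r → ⟦ westEast r ⟧) *_) (Π-* n _ _))) ⟨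
      south * north * Π n (λ r → ⟦ westEast r ⟧ * (⟦ vertices r ⟧ * prodℚ (weights r)))
        ≡⟨ cong (south * north *_) (Π-cong n row-factorises) ⟩
      south * north * Π n rows ∎
      where
      SW = stateWeight lam H V x a anz
      columns = all (λ c → vb lam H V n c ∧ (vb lam H V 0 c ∧ not (inS lam c) ∨ not (vb lam H V 0 c) ∧ inS lam c)) (upTo N)
      south = southBoundary (nth V n [])
      north = northBoundary (nth V 0 [])
      regroup : ∀ a b c d → a * b * c * d ≡ b * (a * (c * d))
      regroup = solve-∀ ℚ-ring

  transfers : Vec ℚ n → List (List Bool) → ℚ
  transfers x V = Π n (λ r → transfer (at x r) (nth V r []) (nth V (suc r) []))

  Z≡∑-transfers : ∀ x → Z lam x a anz
    ≡ ∑ (arrays (suc n) verticals) (λ V → southBoundary (nth V n []) * northBoundary (nth V 0 []) * transfers x V)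
  Z≡∑-transfers x = begin
    Z lam x a anz
      ≡⟨ sumℚ-concatMap _ Hs ⟩
    ∑ Hs (λ H → ∑ Vs (λ V → if valid lam H V then stateWeight lam H V x a anz else 0ℚ))
      ≡⟨ ∑-cong Hs (λ H → ∑-cong Vs (λ V → state-factorises x H V)) ⟩
    ∑ Hs (λ H → ∑ Vs (λ V → boundary V * Π n (rows x H V)))
      ≡⟨ ∑-comm Hs Vs _ ⟩
    ∑ Vs (λ V → ∑ Hs (λ H → boundary V * Π n (rows x H V)))
      ≡⟨ ∑-cong Vs (λ V → trans (∑-*ˡ Hs (boundary V) (λ H → Π n (rows x H V)))
                                (cong (boundary V *_) (∑-arrays-Π (arrays (suc N) bools) [] n (rowWeights V)))) ⟩
    ∑ Vs (λ V → boundary V * transfers x V) ∎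
    where
    Hs = arrays n (arrays (suc N) bools)
    Vs = arrays (suc n) verticals
    boundary : List (List Bool) → ℚ
    boundary V = southBoundary (nth V n []) * northBoundary (nth V 0 [])
    rowWeights : List (List Bool) → ℕ → List Bool → ℚ
    rowWeights V r h = rowWeight (at x r) h (nth V r []) (nth V (suc r) [])

  Z≡chain : ∀ x → Z lam x a anz
    ≡ ∑ verticals (λ v → northBoundary v * chain verticals n (λ r → transfer (at x r)) southBoundary v)
  Z≡chain x = begin
    Z lam x a anz
      ≡⟨ Z≡∑-transfers x ⟩
    ∑ (arrays (suc n) verticals) (λ V → south V * northBoundary (nth V 0 []) * transfers x V)
      ≡⟨ ∑-arrays-suc n verticals _ ⟩
    ∑ Ws (λ W → ∑ verticals (λ v → south (v ∷ W) * northBoundary v * transfers x (v ∷ W)))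
      ≡⟨ ∑-comm Ws verticals _ ⟩
    ∑ verticals (λ v → ∑ Ws (λ W → south (v ∷ W) * northBoundary v * transfers x (v ∷ W)))
      ≡⟨ ∑-cong verticals (λ v → trans (∑-cong Ws (λ W → rotate (south (v ∷ W)) (northBoundary v) (transfers x (v ∷ W))))
                                       (∑-*ˡ Ws (northBoundary v) (λ W → south (v ∷ W) * transfers x (v ∷ W)))) ⟩
    ∑ verticals (λ v → northBoundary v * ∑ Ws (λ W → south (v ∷ W) * transfers x (v ∷ W)))
      ≡⟨ ∑-cong verticals (λ v → cong (northBoundary v *_)
                                       (∑-paths verticals [] southBoundary n (λ r → transfer (at x r)) v)) ⟩
    ∑ verticals (λ v → northBoundary v * chain verticals n (λ r → transfer (at x r)) southBoundary v) ∎
    where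
    Ws = arrays n verticals
    south : List (List Bool) → ℚ
    south V = southBoundary (nth V n [])
    rotate : ∀ a b c → a * b * c ≡ b * (a * c)
    rotate = solve-∀ ℚ-ring

  Z-exchange : ∀ j x → suc j < n → at x j * Z lam x a anz ≡ at x (suc j) * Z lam (swapAt j x) a anz
  Z-exchange j x j+1<n = begin
    at x j * Z lam x a anz
      ≡⟨ cong (at x j *_) (Z≡chain x) ⟩
    at x j * ∑ verticals (λ v → northBoundary v * rowsChain x v)
      ≡⟨ *-∑-inner verticals (at x j) northBoundary (rowsChain x) ⟩
    ∑ verticals (λ v → northBoundary v * (at x j * rowsChain x v))
      ≡⟨ ∑-cong verticals (λ v → cong (northBoundary v *_)
           (chain-swapAt verticals transfer transfer-exchange j n x j+1<n southBoundary v)) ⟩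
    ∑ verticals (λ v → northBoundary v * (at x (suc j) * rowsChain (swapAt j x) v))
      ≡⟨ *-∑-inner verticals (at x (suc j)) northBoundary (rowsChain (swapAt j x)) ⟨
    at x (suc j) * ∑ verticals (λ v → northBoundary v * rowsChain (swapAt j x) v)
      ≡⟨ cong (at x (suc j) *_) (Z≡chain (swapAt j x)) ⟨
    at x (suc j) * Z lam (swapAt j x) a anz ∎
    where
    rowsChain : Vec ℚ n → List Bool → ℚ
    rowsChain y = chain verticals n (λ r → transfer (at y r)) southBoundary

cross-multiply : ∀ p q X Y .{{_ : NonZero p}} .{{_ : NonZero q}} → p * X ≡ q * Y → 1/ q * X ≡ 1/ p * Y
cross-multiply p q X Y pX≡qY = begin
  1/ q * X                  ≡⟨ cong (1/ q *_) (cancel p X) ⟨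
  1/ q * (1/ p * p * X)     ≡⟨ regroup (1/ p) (1/ q) p X ⟩
  1/ p * 1/ q * (p * X)     ≡⟨ cong (1/ p * 1/ q *_) pX≡qY ⟩
  1/ p * 1/ q * (q * Y)     ≡⟨ regroup′ (1/ p) (1/ q) q Y ⟩
  1/ p * (1/ q * q * Y)     ≡⟨ cong (1/ p *_) (cancel q Y) ⟩
  1/ p * Y                  ∎
  where
  cancel : ∀ r Z .{{_ : NonZero r}} → 1/ r * r * Z ≡ Z
  cancel r Z = trans (cong (_* Z) (*-inverseˡ r)) (*-identityˡ Z)
  regroup : ∀ a b c d → b * (a * c * d) ≡ a * b * (c * d)
  regroup = solve-∀ ℚ-ring
  regroup′ : ∀ a b c d → a * b * (c * d) ≡ a * (b * c * d)
  regroup′ = solve-∀ ℚ-ring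

mainTheorem4 : (n : ℕ) → 1 ≤ n → (lam : Vec ℕ n) → IsPartition lam →
    (i : ℕ) → 1 ≤ i → i < n →
    (x : Vec ℚ n) → (a : ℕ → ℚ) → (anz : (k : ℕ) → NonZero (a k)) →
    (nzi : NonZero (at x (i ∸ 1))) → (nzi1 : NonZero (at x i)) →
    (1/ at x i) {{nzi1}} * Z lam x a anz
      ≡ (1/ at x (i ∸ 1)) {{nzi}} * Z lam (swapAt (i ∸ 1) x) a anz
mainTheorem4 n _ lam _ (suc j) _ j+1<n x a anz nzi nzi1 =
  cross-multiply (at x j) (at x (suc j)) _ _ {{nzi}} {{nzi1}} (PartitionFunction.Z-exchange lam a anz j x j+1<n)
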